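{- Let $f\in\mathrm{S}_0^2$ be an $n$-ary Boolean function and let $k$ be an integer with $n/2\le k\le n$. Then the number of $a\in\{0,1\}^n$ with exactly $k$ coordinates equal to 1 and $f(a)=1$ is at least $\binom{n-1}{k-1}$.
   Context: $\mathrm{S}_0^2$ is the set of Boolean functions $f:\{0,1\}^n\to\{0,1\}$ that are 0-separating of degree 2: for every $A\subseteq f^{ -1}(0)$ with $|A|\le 2$ there is an index $i$ with $a_i=0$ for all $a\in A$. -}

module Defs where

open import Data.Bool using (Bool; true; false)
open import Data.Nat using (ℕ; zero; suc; _≤_)
open import Data.Fin using (Fin)
open import Data.Vec using (Vec; []; _∷_; lookup; count)
open import Data.List using (List; []; _∷_; length; map; _++_; filter)
open import Data.List.Relation.Unary.All using (All)
open import Data.Product using (∃)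
open import Relation.Binary.PropositionalEquality using (_≡_)
open import Relation.Nullary.Decidable using (Dec)
open import Data.Bool.Properties using (_≟_)
open import Data.Nat.Properties renaming (_≟_ to _≟ℕ_)

BoolFun : ℕ → Set
BoolFun n = Vec Bool n → Bool

-- A subset of size ≤ 2 is given as a list of at most 2 elements (repetitions harmless).
ZeroSep2 : {n : ℕ} → BoolFun n → Set
ZeroSep2 {n} f =
  (A : List (Vec Bool n)) → length A ≤ 2 → All (λ a → f a ≡ false) A →
  ∃ λ (i : Fin n) → All (λ a → lookup a i ≡ false) A

allVecs : (n : ℕ) → List (Vec Bool n)
allVecs zero = [] ∷ []
allVecs (suc n) = map (false ∷_) (allVecs n) ++ map (true ∷_) (allVecs n)

weight : {n : ℕ} → Vec Bool n → ℕ
weight a = count (λ b → b ≟ true) a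

countLevel : {n : ℕ} → BoolFun n → ℕ → ℕ
countLevel {n} f k =
  length (filter (λ a → f a ≟ true) (filter (λ a → weight a ≟ℕ k) (allVecs n)))

-- Let Z = f⁻¹(0). Any two members of Z share a zero coordinate, so the zero sets
-- of the members of weight k are pairwise intersecting (n − k)-sets with
-- n − k ≤ n / 2. By Erdős–Ko–Rado there are at most C(n − 1, n − k) = C(n − 1, k)
-- of them, which leaves at least C(n, k) − C(n − 1, k) = C(n − 1, k − 1) vectors
-- of weight k on which f is 1.
--
-- Erdős–Ko–Rado is proved by shifting: moving zeros into the first coordinate,
-- pair by pair, keeps level sizes and the common-zero property and terminates in
-- a shifted family. For a shifted family both halves (first coordinate 1, and
-- first coordinate 0 restricted to one level) again have the common-zero property,
-- the second by a pigeonhole argument on the ones, and induction on the dimension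
-- applies. When the level is exactly the middle one, v and its complement cannot
-- both be members, which halves the level.
module Submission where

open import Defs
open import Data.Nat using (ℕ; _≤_; _*_; _∸_)
open import Data.Nat.Combinatorics using (_C_)
open import Data.Nat using (zero; suc; _+_; _<_; _≡ᵇ_; z≤n; s≤s; s≤s⁻¹)
open import Data.Nat.Properties renaming (_≟_ to _≟ℕ_)
open import Data.Nat.Induction using (<-wellFounded)
open import Data.Nat.Combinatorics using (nCk+nC[k+1]≡[n+1]C[k+1]; nCk≡nC[n∸k]; k>n⇒nCk≡0)
open import Algebra.Properties.CommutativeSemigroup +-commutativeSemigroup
  using (interchange; xy∙z≈xz∙y)
open import Data.Bool using (Bool; true; false; not; _∧_; _∨_)
open import Data.Bool.Properties
  using (_≟_; ∧-comm; ∧-zeroʳ; ∧-identityʳ; ∧-conicalˡ; ∧-conicalʳ; ∧-inverseʳ;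
         ∨-comm; ∨-inverseʳ; ¬-not; not-injective; T-≡)
open import Data.Fin using (Fin; zero; suc)
open import Data.Fin.Properties using (any?) renaming (_≟_ to _≟ᶠ_)
open import Data.Vec using (Vec; []; _∷_; lookup; replicate; _[_]≔_)
import Data.Vec as Vec
open import Data.Vec.Properties
  using (lookup∘update; lookup∘update′; []≔-idempotent; []≔-lookup; lookup-replicate;
         lookup-map)
open import Data.List using (List; []; _∷_; length; map; _++_; filter)
open import Data.List.Properties using (map-++; map-∘)
open import Data.Nat.ListAction using (sum)
open import Data.Nat.ListAction.Properties using (sum-++)
open import Data.List.Relation.Unary.All using ([]; _∷_)
open import Data.Product using (∃; ∃₂; _×_; _,_; proj₁; proj₂)
open import Data.Sum using (_⊎_; inj₁; inj₂)
open import Function using (_∘_; Equivalence)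
open import Induction.WellFounded using (Acc; acc)
open import Relation.Nullary using (Dec; yes; no; does; contradiction)
open import Relation.Nullary.Decidable using (map′; _⊎-dec_; _×-dec_)
open import Relation.Unary using (Decidable)
open import Relation.Binary.PropositionalEquality

toℕ : Bool → ℕ
toℕ false = 0
toℕ true  = 1

toℕ-∨-∧ : ∀ a b → toℕ (a ∨ b) + toℕ (a ∧ b) ≡ toℕ a + toℕ b
toℕ-∨-∧ true  true  = refl
toℕ-∨-∧ true  false = refl
toℕ-∨-∧ false true  = refl
toℕ-∨-∧ false false = refl

half-≤ : ∀ {a b} → a + a ≤ b + b → a ≤ b
half-≤ a+a≤b+b = ≮⇒≥ (λ b<a → <⇒≱ (+-mono-< b<a b<a) a+a≤b+b)

half-≡ : ∀ {a b} → a + a ≡ b + b → a ≡ b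
half-≡ eq = ≤-antisym (half-≤ (≤-reflexive eq)) (half-≤ (≤-reflexive (sym eq)))

restrict : ∀ {n} → BoolFun (suc n) → Bool → BoolFun n
restrict X b v = X (b ∷ v)

_⊆_ : ∀ {n} → BoolFun n → BoolFun n → Set
X ⊆ Y = ∀ v → X v ≡ true → Y v ≡ true

levelCount : ∀ {n} → BoolFun n → ℕ → ℕ
levelCount {zero}  X zero    = toℕ (X [])
levelCount {zero}  X (suc k) = 0
levelCount {suc n} X zero    = levelCount (restrict X false) zero
levelCount {suc n} X (suc k) =
  levelCount (restrict X false) (suc k) + levelCount (restrict X true) k

levelCount-cong-local : ∀ {n} {X Y : BoolFun n} k →
  (∀ v → weight v ≡ k → X v ≡ Y v) → levelCount X k ≡ levelCount Y k
levelCount-cong-local {zero}  zero    eq = cong toℕ (eq [] refl)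
levelCount-cong-local {zero}  (suc k) eq = refl
levelCount-cong-local {suc n} zero    eq = levelCount-cong-local zero (eq ∘ (false ∷_))
levelCount-cong-local {suc n} (suc k) eq =
  cong₂ _+_ (levelCount-cong-local (suc k) (eq ∘ (false ∷_)))
            (levelCount-cong-local k (λ v → eq (true ∷ v) ∘ cong suc))

levelCount-cong : ∀ {n} {X Y : BoolFun n} → (∀ v → X v ≡ Y v) →
  ∀ k → levelCount X k ≡ levelCount Y k
levelCount-cong eq k = levelCount-cong-local k (λ v _ → eq v)

levelCount-mono : ∀ {n} {X Y : BoolFun n} → X ⊆ Y → ∀ k → levelCount X k ≤ levelCount Y k
levelCount-mono {zero} {X} {Y} X⊆Y zero with X [] in e
... | true  = ≤-reflexive (cong toℕ (sym (X⊆Y [] e)))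
... | false = z≤n
levelCount-mono {zero}  X⊆Y (suc k) = z≤n
levelCount-mono {suc n} X⊆Y zero    = levelCount-mono (X⊆Y ∘ (false ∷_)) zero
levelCount-mono {suc n} X⊆Y (suc k) =
  +-mono-≤ (levelCount-mono (X⊆Y ∘ (false ∷_)) (suc k)) (levelCount-mono (X⊆Y ∘ (true ∷_)) k)

levelCount-linear : ∀ {n} {X Y U W : BoolFun n} →
  (∀ v → toℕ (X v) + toℕ (Y v) ≡ toℕ (U v) + toℕ (W v)) →
  ∀ k → levelCount X k + levelCount Y k ≡ levelCount U k + levelCount W k
levelCount-linear {zero}  eq zero    = eq []
levelCount-linear {zero}  eq (suc k) = refl
levelCount-linear {suc n} eq zero    = levelCount-linear (eq ∘ (false ∷_)) zero
levelCount-linear {suc n} {X} {Y} {U} {W} eq (suc k) = begin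
  (lc X false (suc k) + lc X true k) + (lc Y false (suc k) + lc Y true k)
    ≡⟨ interchange (lc X false (suc k)) _ _ _ ⟩
  (lc X false (suc k) + lc Y false (suc k)) + (lc X true k + lc Y true k)
    ≡⟨ cong₂ _+_ (levelCount-linear (eq ∘ (false ∷_)) (suc k))
                 (levelCount-linear (eq ∘ (true ∷_)) k) ⟩
  (lc U false (suc k) + lc W false (suc k)) + (lc U true k + lc W true k)
    ≡⟨ interchange (lc U false (suc k)) _ _ _ ⟩
  (lc U false (suc k) + lc U true k) + (lc W false (suc k) + lc W true k) ∎
  where
  open ≡-Reasoning
  lc : BoolFun (suc n) → Bool → ℕ → ℕ
  lc Z b = levelCount (restrict Z b)

levelCount-empty : ∀ {n} {X : BoolFun n} → (∀ v → X v ≡ false) → ∀ k → levelCount X k ≡ 0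
levelCount-empty {zero}  empty zero    = cong toℕ (empty [])
levelCount-empty {zero}  empty (suc k) = refl
levelCount-empty {suc n} empty zero    = levelCount-empty (empty ∘ (false ∷_)) zero
levelCount-empty {suc n} empty (suc k) =
  cong₂ _+_ (levelCount-empty (empty ∘ (false ∷_)) (suc k)) (levelCount-empty (empty ∘ (true ∷_)) k)

levelCount-full : ∀ n k → levelCount {n} (λ _ → true) k ≡ n C k
levelCount-full zero    zero    = refl
levelCount-full zero    (suc k) = refl
levelCount-full (suc n) zero    = levelCount-full n zero
levelCount-full (suc n) (suc k) = begin
  levelCount {n} (λ _ → true) (suc k) + levelCount {n} (λ _ → true) k
    ≡⟨ cong₂ _+_ (levelCount-full n (suc k)) (levelCount-full n k) ⟩
  n C suc k + n C k   ≡⟨ +-comm (n C suc k) (n C k) ⟩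
  n C k + n C suc k   ≡⟨ nCk+nC[k+1]≡[n+1]C[k+1] n k ⟩
  suc n C suc k       ∎
  where open ≡-Reasoning

levelCount≤C : ∀ {n} (X : BoolFun n) k → levelCount X k ≤ n C k
levelCount≤C {n} X k =
  ≤-trans (levelCount-mono {X = X} {Y = λ _ → true} (λ _ _ → refl) k)
          (≤-reflexive (levelCount-full n k))

levelCount-beyond : ∀ {n} (X : BoolFun n) {k} → n < k → levelCount X k ≡ 0
levelCount-beyond X {k} n<k = n≤0⇒n≡0 (subst (levelCount X k ≤_) (k>n⇒nCk≡0 n<k) (levelCount≤C X k))

levelCount-∨ : ∀ {n} (X Y : BoolFun n) → (∀ v → X v ∧ Y v ≡ false) →
  ∀ k → levelCount X k + levelCount Y k ≡ levelCount (λ v → X v ∨ Y v) k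
levelCount-∨ X Y disjoint k = begin
  levelCount X k + levelCount Y k
    ≡⟨ levelCount-linear (λ v → sym (toℕ-∨-∧ (X v) (Y v))) k ⟩
  levelCount (λ v → X v ∨ Y v) k + levelCount (λ v → X v ∧ Y v) k
    ≡⟨ cong (levelCount (λ v → X v ∨ Y v) k +_) (levelCount-empty disjoint k) ⟩
  levelCount (λ v → X v ∨ Y v) k + 0
    ≡⟨ +-identityʳ _ ⟩
  levelCount (λ v → X v ∨ Y v) k ∎
  where open ≡-Reasoning

levelCount-+-not : ∀ {n} (X : BoolFun n) k → levelCount X k + levelCount (not ∘ X) k ≡ n C k
levelCount-+-not {n} X k = begin
  levelCount X k + levelCount (not ∘ X) k  ≡⟨ levelCount-∨ X (not ∘ X) (∧-inverseʳ ∘ X) k ⟩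
  levelCount (λ v → X v ∨ not (X v)) k     ≡⟨ levelCount-cong (∨-inverseʳ ∘ X) k ⟩
  levelCount {n} (λ _ → true) k            ≡⟨ levelCount-full n k ⟩
  n C k                                    ∎
  where open ≡-Reasoning

levelCount-∘-complement : ∀ {n} (X : BoolFun n) k j → k + j ≡ n →
  levelCount (X ∘ Vec.map not) k ≡ levelCount X j
levelCount-∘-complement {zero}  X zero    zero    refl = refl
levelCount-∘-complement {suc n} X zero    .(suc n) refl = begin
  levelCount (restrict X true ∘ Vec.map not) zero
    ≡⟨ levelCount-∘-complement (restrict X true) zero n refl ⟩
  levelCount (restrict X true) n
    ≡⟨ cong (_+ levelCount (restrict X true) n) (sym (levelCount-beyond _ (n<1+n n))) ⟩
  levelCount X (suc n) ∎
  where open ≡-Reasoning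
levelCount-∘-complement {suc n} X (suc k) zero    1+k+0≡1+n = begin
  levelCount (restrict X true ∘ Vec.map not) (suc k) + levelCount (restrict X false ∘ Vec.map not) k
    ≡⟨ cong₂ _+_ (levelCount-beyond _ n<1+k) (levelCount-∘-complement _ k zero k+0≡n) ⟩
  levelCount X zero ∎
  where
  open ≡-Reasoning
  k+0≡n : k + 0 ≡ n
  k+0≡n = suc-injective 1+k+0≡1+n
  n<1+k : n < suc k
  n<1+k = s≤s (≤-reflexive (trans (sym k+0≡n) (+-identityʳ k)))
levelCount-∘-complement {suc n} X (suc k) (suc j) k+j≡n = begin
  levelCount (restrict X true ∘ Vec.map not) (suc k) + levelCount (restrict X false ∘ Vec.map not) k
    ≡⟨ cong₂ _+_ (levelCount-∘-complement _ (suc k) j (trans (sym (+-suc k j)) k+1+j≡n))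
                 (levelCount-∘-complement _ k (suc j) k+1+j≡n) ⟩
  levelCount (restrict X true) j + levelCount (restrict X false) (suc j)
    ≡⟨ +-comm (levelCount (restrict X true) j) _ ⟩
  levelCount X (suc j) ∎
  where
  open ≡-Reasoning
  k+1+j≡n : k + suc j ≡ n
  k+1+j≡n = suc-injective k+j≡n

size : ∀ {n} → BoolFun n → ℕ
size {zero}  X = toℕ (X [])
size {suc n} X = size (restrict X false) + size (restrict X true)

size-mono : ∀ {n} {X Y : BoolFun n} → X ⊆ Y → size X ≤ size Y
size-mono {zero} {X} {Y} X⊆Y with X [] in e
... | true  = ≤-reflexive (cong toℕ (sym (X⊆Y [] e)))
... | false = z≤n
size-mono {suc n} X⊆Y = +-mono-≤ (size-mono (X⊆Y ∘ (false ∷_))) (size-mono (X⊆Y ∘ (true ∷_)))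

size-mono-< : ∀ {n} {X Y : BoolFun n} → X ⊆ Y → ∀ w → X w ≡ false → Y w ≡ true → size X < size Y
size-mono-< {zero}  X⊆Y [] Xw≡false Yw≡true rewrite Xw≡false | Yw≡true = s≤s z≤n
size-mono-< {suc n} X⊆Y (false ∷ w) Xw≡false Yw≡true =
  +-mono-<-≤ (size-mono-< (X⊆Y ∘ (false ∷_)) w Xw≡false Yw≡true) (size-mono (X⊆Y ∘ (true ∷_)))
size-mono-< {suc n} X⊆Y (true ∷ w) Xw≡false Yw≡true =
  +-mono-≤-< (size-mono (X⊆Y ∘ (false ∷_))) (size-mono-< (X⊆Y ∘ (true ∷_)) w Xw≡false Yw≡true)

length-filter-filter : ∀ {A : Set} {P Q : A → Set} (P? : Decidable P) (Q? : Decidable Q) xs →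
  length (filter P? (filter Q? xs)) ≡ sum (map (λ x → toℕ (does (Q? x) ∧ does (P? x))) xs)
length-filter-filter P? Q? [] = refl
length-filter-filter P? Q? (x ∷ xs) with does (Q? x)
... | false = length-filter-filter P? Q? xs
... | true with does (P? x)
...   | false = length-filter-filter P? Q? xs
...   | true  = cong suc (length-filter-filter P? Q? xs)

sum-map-allVecs : ∀ {n} (h : Vec Bool (suc n) → ℕ) → sum (map h (allVecs (suc n))) ≡
  sum (map (h ∘ (false ∷_)) (allVecs n)) + sum (map (h ∘ (true ∷_)) (allVecs n))
sum-map-allVecs {n} h = begin
  sum (map h (map (false ∷_) (allVecs n) ++ map (true ∷_) (allVecs n)))
    ≡⟨ cong sum (map-++ h (map (false ∷_) (allVecs n)) _) ⟩
  sum (map h (map (false ∷_) (allVecs n)) ++ map h (map (true ∷_) (allVecs n)))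
    ≡⟨ sum-++ (map h (map (false ∷_) (allVecs n))) _ ⟩
  sum (map h (map (false ∷_) (allVecs n))) + sum (map h (map (true ∷_) (allVecs n)))
    ≡⟨ sym (cong₂ _+_ (cong sum (map-∘ (allVecs n))) (cong sum (map-∘ (allVecs n)))) ⟩
  sum (map (h ∘ (false ∷_)) (allVecs n)) + sum (map (h ∘ (true ∷_)) (allVecs n)) ∎
  where open ≡-Reasoning

indicator : ∀ {n} → BoolFun n → ℕ → Vec Bool n → ℕ
indicator f k a = toℕ (does (weight a ≟ℕ k) ∧ does (f a ≟ true))

sum-map-zero : ∀ {A : Set} (xs : List A) → sum (map (λ _ → 0) xs) ≡ 0
sum-map-zero []       = refl
sum-map-zero (x ∷ xs) = sum-map-zero xs

sum-allVecs≡levelCount : ∀ {n} (f : BoolFun n) k →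
  sum (map (indicator f k) (allVecs n)) ≡ levelCount f k
sum-allVecs≡levelCount {zero} f zero with f []
... | true  = refl
... | false = refl
sum-allVecs≡levelCount {zero}  f (suc k) = refl
sum-allVecs≡levelCount {suc n} f zero = begin
  sum (map (indicator f zero) (allVecs (suc n)))
    ≡⟨ sum-map-allVecs (indicator f zero) ⟩
  sum (map (indicator (restrict f false) zero) (allVecs n)) + sum (map (λ _ → 0) (allVecs n))
    ≡⟨ cong₂ _+_ (sum-allVecs≡levelCount (restrict f false) zero) (sum-map-zero (allVecs n)) ⟩
  levelCount f zero + 0
    ≡⟨ +-identityʳ _ ⟩
  levelCount f zero ∎
  where open ≡-Reasoning
sum-allVecs≡levelCount {suc n} f (suc k) =
  trans (sum-map-allVecs (indicator f (suc k)))
        (cong₂ _+_ (sum-allVecs≡levelCount (restrict f false) (suc k))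
                   (sum-allVecs≡levelCount (restrict f true) k))

countLevel≡levelCount : ∀ {n} (f : BoolFun n) k → countLevel f k ≡ levelCount f k
countLevel≡levelCount {n} f k =
  trans (length-filter-filter (λ a → f a ≟ true) (λ a → weight a ≟ℕ k) (allVecs n))
        (sum-allVecs≡levelCount f k)

swapHead : ∀ {a} {A : Set a} {n} → Fin n → Vec A (suc n) → Vec A (suc n)
swapHead j (x ∷ xs) = lookup xs j ∷ (xs [ j ]≔ x)

swapHead-involutive : ∀ {a} {A : Set a} {n} (j : Fin n) (xs : Vec A (suc n)) →
  swapHead j (swapHead j xs) ≡ xs
swapHead-involutive j (x ∷ xs) =
  cong₂ _∷_ (lookup∘update j xs x) (trans ([]≔-idempotent xs j) ([]≔-lookup xs j))

levelCount-∘-swapHead-zero : ∀ {n} (X : BoolFun (suc (suc n))) k →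
  levelCount (X ∘ swapHead zero) k ≡ levelCount X k
levelCount-∘-swapHead-zero X zero          = refl
levelCount-∘-swapHead-zero X (suc zero)    =
  xy∙z≈xz∙y (c false false 1) (c true false 0) (c false true 0)
  where c = λ a b → levelCount (λ v → X (a ∷ b ∷ v))
levelCount-∘-swapHead-zero X (suc (suc k)) =
  interchange (c false false (suc (suc k))) (c true false (suc k))
              (c false true (suc k)) (c true true k)
  where c = λ a b → levelCount (λ v → X (a ∷ b ∷ v))

-- The transposition (0 j+1) is (0 1) ∘ (1 j+1) ∘ (0 1), and (1 j+1) acts on the tail only.
levelCount-∘-swapHead : ∀ {n} (j : Fin n) (X : BoolFun (suc n)) k →
  levelCount (X ∘ swapHead j) k ≡ levelCount X k
levelCount-∘-swapHead zero    X k = levelCount-∘-swapHead-zero X k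
levelCount-∘-swapHead (suc j) X k = begin
  levelCount (X ∘ swapHead (suc j)) k            ≡⟨ levelCount-cong conjugate k ⟩
  levelCount (W ∘ swapHead zero) k               ≡⟨ levelCount-∘-swapHead-zero W k ⟩
  levelCount W k                                 ≡⟨ swap-tail k ⟩
  levelCount (X ∘ swapHead zero) k               ≡⟨ levelCount-∘-swapHead-zero X k ⟩
  levelCount X k                                 ∎
  where
  open ≡-Reasoning
  W : BoolFun _
  W (x ∷ xs) = X (swapHead zero (x ∷ swapHead j xs))
  conjugate : ∀ v → X (swapHead (suc j) v) ≡ W (swapHead zero v)
  conjugate (x ∷ y ∷ xs) = refl
  swap-tail : ∀ k → levelCount W k ≡ levelCount (X ∘ swapHead zero) k
  swap-tail zero    = levelCount-∘-swapHead j (restrict (X ∘ swapHead zero) false) zero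
  swap-tail (suc k) =
    cong₂ _+_ (levelCount-∘-swapHead j (half false) (suc k)) (levelCount-∘-swapHead j (half true) k)
    where half = restrict (X ∘ swapHead zero)

CommonZero : ∀ {n} → Vec Bool n → Vec Bool n → Set
CommonZero {n} a b = ∃ λ (i : Fin n) → lookup a i ≡ false × lookup b i ≡ false

ZeroIntersecting : ∀ {n} → BoolFun n → Set
ZeroIntersecting Z = ∀ a b → Z a ≡ true → Z b ≡ true → CommonZero a b

ZeroSep2⇒ZeroIntersecting : ∀ {n} {f : BoolFun n} → ZeroSep2 f → ZeroIntersecting (not ∘ f)
ZeroSep2⇒ZeroIntersecting sep a b fa≡false fb≡false
  with sep (a ∷ b ∷ []) (s≤s (s≤s z≤n)) (not-injective fa≡false ∷ not-injective fb≡false ∷ [])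
... | i , ai≡false ∷ bi≡false ∷ [] = i , ai≡false , bi≡false

ZeroIntersecting-replicate-true : ∀ {n} {Z : BoolFun n} → ZeroIntersecting Z →
  Z (replicate n true) ≡ false
ZeroIntersecting-replicate-true {n} I = ¬-not λ Z1≡true →
  let i , 1≡false , _ = I _ _ Z1≡true Z1≡true
  in  contradiction (trans (sym (lookup-replicate i true)) 1≡false) λ ()

ZeroIntersecting-complement : ∀ {n} {Z : BoolFun n} → ZeroIntersecting Z →
  ∀ v → Z v ∧ Z (Vec.map not v) ≡ false
ZeroIntersecting-complement {Z = Z} I v with Z v in Zv | Z (Vec.map not v) in Zv̄
... | false | _     = refl
... | true  | false = refl
... | true  | true  =
  let i , vi≡false , v̄i≡false = I _ _ Zv Zv̄
      vi≡true = not-injective (trans (sym (lookup-map i not v)) v̄i≡false)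
  in  contradiction (trans (sym vi≡true) vi≡false) λ ()

ZeroIntersecting-restrict-true : ∀ {n} {Z : BoolFun (suc n)} → ZeroIntersecting Z →
  ZeroIntersecting (restrict Z true)
ZeroIntersecting-restrict-true I a b Za Zb with I _ _ Za Zb
... | suc i , ai≡false , bi≡false = i , ai≡false , bi≡false

levelCount-middle-≤ : ∀ {n} {Z : BoolFun (suc n)} k → ZeroIntersecting Z → k + k ≡ suc n →
  levelCount Z k ≤ n C k
levelCount-middle-≤ zero    I ()
levelCount-middle-≤ {n} {Z} (suc k) I k+k≡n = half-≤ (begin
  c + c
    ≡⟨ cong (c +_) (sym (levelCount-∘-complement Z (suc k) (suc k) k+k≡n)) ⟩
  c + levelCount Z̄ (suc k)
    ≡⟨ levelCount-∨ Z Z̄ (ZeroIntersecting-complement I) (suc k) ⟩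
  levelCount (λ v → Z v ∨ Z̄ v) (suc k)
    ≤⟨ levelCount≤C (λ v → Z v ∨ Z̄ v) (suc k) ⟩
  suc n C suc k
    ≡⟨ sym (nCk+nC[k+1]≡[n+1]C[k+1] n k) ⟩
  n C k + n C suc k
    ≡⟨ cong (_+ n C suc k) symmetric ⟩
  n C suc k + n C suc k ∎)
  where
  open ≤-Reasoning
  c = levelCount Z (suc k)
  Z̄ = Z ∘ Vec.map not
  n≡k+1+k : n ≡ k + suc k
  n≡k+1+k = suc-injective (sym k+k≡n)
  symmetric : n C k ≡ n C suc k
  symmetric = begin-equality
    n C k             ≡⟨ nCk≡nC[n∸k] (subst (k ≤_) (sym n≡k+1+k) (m≤m+n k (suc k))) ⟩
    n C (n ∸ k)       ≡⟨ cong (λ m → n C (m ∸ k)) n≡k+1+k ⟩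
    n C (k + suc k ∸ k) ≡⟨ cong (n C_) (m+n∸m≡n k (suc k)) ⟩
    n C suc k         ∎

-- merge x t_j (Z v) (Z v′) is the new membership of v = x ∷ t, where v′ = swapHead j v.
-- Of a pair {v, v′} with x ≠ t_j, the vector with its zero in coordinate 0 becomes a
-- member if either was one, the other stays a member only if both were.
merge : Bool → Bool → Bool → Bool → Bool
merge true  true  a c = a
merge true  false a c = a ∨ c
merge false true  a c = a ∧ c
merge false false a c = a

shift : ∀ {n} → Fin n → BoolFun (suc n) → BoolFun (suc n)
shift j Z (x ∷ t) = merge x (lookup t j) (Z (x ∷ t)) (Z (swapHead j (x ∷ t)))

merge-conserves : ∀ x b a c → toℕ (merge x b a c) + toℕ (merge b x c a) ≡ toℕ a + toℕ c
merge-conserves true  true  a c = refl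
merge-conserves false false a c = refl
merge-conserves true  false a c =
  trans (cong (λ d → toℕ (a ∨ c) + toℕ d) (∧-comm c a)) (toℕ-∨-∧ a c)
merge-conserves false true  a c =
  trans (cong (λ d → toℕ (a ∧ c) + toℕ d) (∨-comm c a))
        (trans (+-comm (toℕ (a ∧ c)) _) (toℕ-∨-∧ a c))

shift-conserves : ∀ {n} (j : Fin n) Z v →
  toℕ (shift j Z v) + toℕ (shift j Z (swapHead j v)) ≡ toℕ (Z v) + toℕ (Z (swapHead j v))
shift-conserves j Z (x ∷ t) = begin
  toℕ (merge x b a c) + toℕ (shift j Z (swapHead j (x ∷ t)))
    ≡⟨ cong (λ s → toℕ (merge x b a c) + toℕ s) shift-at-swap ⟩
  toℕ (merge x b a c) + toℕ (merge b x c a)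
    ≡⟨ merge-conserves x b a c ⟩
  toℕ a + toℕ c ∎
  where
  open ≡-Reasoning
  b = lookup t j
  a = Z (x ∷ t)
  c = Z (swapHead j (x ∷ t))
  shift-at-swap : shift j Z (swapHead j (x ∷ t)) ≡ merge b x c a
  shift-at-swap =
    cong₂ (λ y w → merge b y c (Z w)) (lookup∘update j t x) (swapHead-involutive j (x ∷ t))

-- Counting once directly and once through swapHead j visits both members of every pair
-- {v, swapHead j v}, and within a pair shift only redistributes membership.
levelCount-shift : ∀ {n} (j : Fin n) Z k → levelCount (shift j Z) k ≡ levelCount Z k
levelCount-shift j Z k = half-≡ (begin
  levelCount (shift j Z) k + levelCount (shift j Z) k
    ≡⟨ cong (levelCount (shift j Z) k +_) (sym (levelCount-∘-swapHead j (shift j Z) k)) ⟩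
  levelCount (shift j Z) k + levelCount (shift j Z ∘ swapHead j) k
    ≡⟨ levelCount-linear (shift-conserves j Z) k ⟩
  levelCount Z k + levelCount (Z ∘ swapHead j) k
    ≡⟨ cong (levelCount Z k +_) (levelCount-∘-swapHead j Z k) ⟩
  levelCount Z k + levelCount Z k ∎)
  where open ≡-Reasoning

Kept : ∀ {n} → Fin n → BoolFun (suc n) → Vec Bool (suc n) → Set
Kept j Z (x ∷ t) =
  Z (x ∷ t) ≡ true × (x ≡ false → lookup t j ≡ true → Z (swapHead j (x ∷ t)) ≡ true)

Moved : ∀ {n} → Fin n → BoolFun (suc n) → Vec Bool (suc n) → Set
Moved j Z (x ∷ t) = x ≡ true × lookup t j ≡ false × Z (swapHead j (x ∷ t)) ≡ true

merge-true : ∀ x b a c → merge x b a c ≡ true →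
  (a ≡ true × (x ≡ false → b ≡ true → c ≡ true)) ⊎ (x ≡ true × b ≡ false × c ≡ true)
merge-true true  true  a     c     a≡true = inj₁ (a≡true , λ ())
merge-true false false a     c     a≡true = inj₁ (a≡true , λ _ ())
merge-true true  false true  c     _      = inj₁ (refl , λ ())
merge-true true  false false c     c≡true = inj₂ (refl , refl , c≡true)
merge-true false true  true  true  _      = inj₁ (refl , λ _ _ → refl)
merge-true false true  true  false ()
merge-true false true  false c     ()

shift-member : ∀ {n} (j : Fin n) Z v → shift j Z v ≡ true → Kept j Z v ⊎ Moved j Z v
shift-member j Z (x ∷ t) = merge-true x (lookup t j) _ _

lookup-[]≔true : ∀ {n} (t : Vec Bool n) j i → lookup (t [ j ]≔ true) i ≡ false →
  i ≢ j × lookup t i ≡ false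
lookup-[]≔true t j i ti≡false with i ≟ᶠ j
... | yes refl = contradiction (trans (sym (lookup∘update i t true)) ti≡false) λ ()
... | no i≢j   = i≢j , trans (sym (lookup∘update′ i≢j t true)) ti≡false

-- The moved vector's partner (0 ∷ t[j]≔1) meets the kept one in a zero; away from the
-- first coordinate it is a zero of t as well. At the first coordinate it forces the kept
-- vector to be 0 ∷ u, and then either u_j = 0 or the partner of 0 ∷ u is a member too.
moved-kept-CommonZero : ∀ {n} (j : Fin n) {Z} → ZeroIntersecting Z → ∀ t {y u} →
  lookup t j ≡ false → Z (swapHead j (true ∷ t)) ≡ true → Kept j Z (y ∷ u) →
  CommonZero (true ∷ t) (y ∷ u)
moved-kept-CommonZero j I t {y} {u} tj≡false Zt′ (Zyu , lower) with I _ _ Zt′ Zyu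
... | suc i , t′i≡false , ui≡false = suc i , proj₂ (lookup-[]≔true t j i t′i≡false) , ui≡false
... | zero  , _ , y≡false with lookup u j ≟ false
...   | yes uj≡false = suc j , tj≡false , uj≡false
...   | no uj≢false with I _ _ Zt′ (lower y≡false (¬-not uj≢false))
...     | zero  , _ , uj≡false = contradiction uj≡false uj≢false
...     | suc i , t′i≡false , u′i≡false =
  let i≢j , ti≡false = lookup-[]≔true t j i t′i≡false
  in  suc i , ti≡false , trans (sym (lookup∘update′ i≢j u y)) u′i≡false

shift-ZeroIntersecting : ∀ {n} (j : Fin n) {Z} → ZeroIntersecting Z → ZeroIntersecting (shift j Z)
shift-ZeroIntersecting j {Z} I a@(x ∷ t) b@(y ∷ u) Sa Sb
  with shift-member j Z a Sa | shift-member j Z b Sb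
... | inj₁ (Za , _)           | inj₁ (Zb , _)           = I a b Za Zb
... | inj₂ (refl , tj , _)    | inj₂ (refl , uj , _)    = suc j , tj , uj
... | inj₂ (refl , tj , Zt′)  | inj₁ kept               = moved-kept-CommonZero j I t tj Zt′ kept
... | inj₁ kept               | inj₂ (refl , uj , Zu′)  =
  let i , bi , ai = moved-kept-CommonZero j I u uj Zu′ kept in i , ai , bi

ShiftWitness : ∀ {n} → BoolFun (suc n) → Fin n → Vec Bool n → Set
ShiftWitness Z j t =
  lookup t j ≡ true × Z (false ∷ t) ≡ true × Z (swapHead j (false ∷ t)) ≡ false

size-shift-< : ∀ {n} {Z : BoolFun (suc n)} j t → ShiftWitness Z j t →
  size (restrict (shift j Z) false) < size (restrict Z false)
size-shift-< {Z = Z} j t (tj , Zv , Zv′) = size-mono-< shrinks t removed Zv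
  where
  shrinks : restrict (shift j Z) false ⊆ restrict Z false
  shrinks s Ss with shift-member j Z (false ∷ s) Ss
  ... | inj₁ (Zs , _) = Zs
  ... | inj₂ (() , _)
  removed : shift j Z (false ∷ t) ≡ false
  removed = trans (cong₂ (λ b c → merge false b (Z (false ∷ t)) c) tj Zv′) (∧-zeroʳ _)

Shifted : ∀ {n} → BoolFun (suc n) → Set
Shifted {n} Z = ∀ (j : Fin n) t →
  lookup t j ≡ true → Z (false ∷ t) ≡ true → Z (swapHead j (false ∷ t)) ≡ true

anyVecBool? : ∀ {n} {P : Vec Bool n → Set} → (∀ v → Dec (P v)) → Dec (∃ P)
anyVecBool? {zero}          P? = map′ ([] ,_) (λ { ([] , p) → p }) (P? [])
anyVecBool? {suc n} {P = P} P? =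
  map′ cons uncons (anyVecBool? (P? ∘ (false ∷_)) ⊎-dec anyVecBool? (P? ∘ (true ∷_)))
  where
  cons : ∃ (P ∘ (false ∷_)) ⊎ ∃ (P ∘ (true ∷_)) → ∃ P
  cons (inj₁ (v , p)) = false ∷ v , p
  cons (inj₂ (v , p)) = true ∷ v , p
  uncons : ∃ P → ∃ (P ∘ (false ∷_)) ⊎ ∃ (P ∘ (true ∷_))
  uncons (false ∷ v , p) = inj₁ (v , p)
  uncons (true ∷ v , p)  = inj₂ (v , p)

shifted? : ∀ {n} (Z : BoolFun (suc n)) → Shifted Z ⊎ ∃₂ (ShiftWitness Z)
shifted? Z with any? (λ j → anyVecBool? (λ t →
    lookup t j ≟ true ×-dec Z (false ∷ t) ≟ true ×-dec Z (swapHead j (false ∷ t)) ≟ false))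
... | yes (j , t , witness) = inj₂ (j , t , witness)
... | no no-witness = inj₁ λ j t tj Zt → ¬-not λ Zt′ → no-witness (j , t , tj , Zt , Zt′)

stabilise : ∀ {n} (Z : BoolFun (suc n)) → ZeroIntersecting Z →
  ∃ λ Z′ → Shifted Z′ × ZeroIntersecting Z′ × (∀ k → levelCount Z′ k ≡ levelCount Z k)
stabilise Z I = go Z I (<-wellFounded _)
  where
  go : ∀ Z → ZeroIntersecting Z → Acc _<_ (size (restrict Z false)) →
    ∃ λ Z′ → Shifted Z′ × ZeroIntersecting Z′ × (∀ k → levelCount Z′ k ≡ levelCount Z k)
  go Z I (acc rec) with shifted? Z
  ... | inj₁ shifted = Z , shifted , I , λ _ → refl
  ... | inj₂ (j , t , witness)
    with go (shift j Z) (shift-ZeroIntersecting j I) (rec (size-shift-< {Z = Z} j t witness))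
  ...   | Z′ , shifted , I′ , same =
    Z′ , shifted , I′ , λ k → trans (same k) (levelCount-shift j Z k)

common-one : ∀ {n} (a b : Vec Bool n) → n < weight a + weight b →
  ∃ λ j → lookup a j ≡ true × lookup b j ≡ true
common-one []          []          ()
common-one (true  ∷ a) (true  ∷ b) _ = zero , refl , refl
common-one {suc n} (false ∷ a) (false ∷ b) n<a+b
  with j , aj , bj ← common-one a b (<-trans (n<1+n n) n<a+b) = suc j , aj , bj
common-one {suc n} (false ∷ a) (true  ∷ b) n<a+b
  with j , aj , bj ← common-one a b (s≤s⁻¹ (subst (suc n <_) (+-suc (weight a) (weight b)) n<a+b))
  = suc j , aj , bj
common-one {suc n} (true  ∷ a) (false ∷ b) n<a+b
  with j , aj , bj ← common-one a b (s≤s⁻¹ n<a+b) = suc j , aj , bj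

atLevel : ∀ {n} → ℕ → BoolFun n → BoolFun n
atLevel k X v = X v ∧ (weight v ≡ᵇ k)

levelCount-atLevel : ∀ {n} k (X : BoolFun n) → levelCount (atLevel k X) k ≡ levelCount X k
levelCount-atLevel k X = levelCount-cong-local k λ v wv≡k →
  trans (cong (X v ∧_) (Equivalence.to T-≡ (≡⇒≡ᵇ _ _ wv≡k))) (∧-identityʳ (X v))

atLevel-member : ∀ {n} k (X : BoolFun n) v → atLevel k X v ≡ true → X v ≡ true × weight v ≡ k
atLevel-member k X v e =
  ∧-conicalˡ _ _ e , ≡ᵇ⇒≡ _ _ (Equivalence.from T-≡ (∧-conicalʳ (X v) _ e))

-- Two members of weight k > n / 2 share a one at some j; shifting moves the other's one at j
-- to the first coordinate, so the common zero of the first with that shifted vector avoids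
-- both coordinates.
ZeroIntersecting-atLevel-restrict-false : ∀ {n} {Z : BoolFun (suc n)} k →
  Shifted Z → ZeroIntersecting Z → n < k + k → ZeroIntersecting (atLevel k (restrict Z false))
ZeroIntersecting-atLevel-restrict-false {n} {Z} k shifted I n<2k a b ∈a ∈b
  with Za , wa ← atLevel-member k (restrict Z false) a ∈a
     | Zb , wb ← atLevel-member k (restrict Z false) b ∈b
  with j , aj , bj ← common-one a b (subst₂ (λ x y → n < x + y) (sym wa) (sym wb) n<2k)
  with I (false ∷ a) (swapHead j (false ∷ b)) Za (shifted j b bj Zb)
... | zero  , _ , bj≡false = contradiction (trans (sym bj) bj≡false) λ ()
... | suc i , ai≡false , b′i≡false with i ≟ᶠ j
...   | yes refl = contradiction (trans (sym aj) ai≡false) λ ()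
...   | no i≢j   = i , ai≡false , trans (sym (lookup∘update′ i≢j b false)) b′i≡false

-- Erdős–Ko–Rado for the zero sets: they are intersecting (n + 1 − k)-sets with
-- n + 1 − k ≤ (n + 1) / 2, so there are at most C(n, n − k) = C(n, k) of them.
erdős-ko-rado : ∀ n (Z : BoolFun (suc n)) k → ZeroIntersecting Z → suc n ≤ k + k →
  levelCount Z k ≤ n C k
erdős-ko-rado n       Z zero          I ()
erdős-ko-rado zero    Z (suc zero)    I _ =
  ≤-reflexive (cong toℕ (ZeroIntersecting-replicate-true I))
erdős-ko-rado zero    Z (suc (suc k)) I _ = z≤n
erdős-ko-rado (suc m) Z (suc k)       I n≤2k with suc k + suc k ≟ℕ suc (suc m)
... | yes middle = levelCount-middle-≤ (suc k) I middle
... | no ¬middle with Z′ , shifted , I′ , same ← stabilise Z I = begin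
  levelCount Z (suc k)
    ≡⟨ sym (same (suc k)) ⟩
  levelCount Z₀ (suc k) + levelCount Z₁ k
    ≡⟨ cong (_+ levelCount Z₁ k) (sym (levelCount-atLevel (suc k) Z₀)) ⟩
  levelCount (atLevel (suc k) Z₀) (suc k) + levelCount Z₁ k
    ≤⟨ +-mono-≤ bound₀ bound₁ ⟩
  m C suc k + m C k
    ≡⟨ +-comm (m C suc k) (m C k) ⟩
  m C k + m C suc k
    ≡⟨ nCk+nC[k+1]≡[n+1]C[k+1] m k ⟩
  suc m C suc k ∎
  where
  open ≤-Reasoning
  Z₀ = restrict Z′ false
  Z₁ = restrict Z′ true
  bound₀ : levelCount (atLevel (suc k) Z₀) (suc k) ≤ m C suc k
  bound₀ = erdős-ko-rado m _ (suc k)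
    (ZeroIntersecting-atLevel-restrict-false (suc k) shifted I′ n≤2k) (<⇒≤ n≤2k)
  1+m≤2k : suc m ≤ k + k
  1+m≤2k = s≤s⁻¹ (s≤s⁻¹ (subst (suc (suc m) <_) (cong suc (+-suc k k))
                                 (≤∧≢⇒< n≤2k (¬middle ∘ sym))))
  bound₁ : levelCount Z₁ k ≤ m C k
  bound₁ = erdős-ko-rado m Z₁ k (ZeroIntersecting-restrict-true I′) 1+m≤2k

lemma1 : (n : ℕ) (f : BoolFun n) → ZeroSep2 f → (k : ℕ) →
         n ≤ 2 * k → k ≤ n → (n ∸ 1) C (k ∸ 1) ≤ countLevel f k
lemma1 zero    f sep k       _    _ with () ← proj₁ (sep [] z≤n [])
lemma1 (suc n) f sep zero    ()   _
lemma1 (suc n) f sep (suc k) n≤2k _ = +-cancelʳ-≤ (levelCount Z (suc k)) _ _ (begin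
  n C k + levelCount Z (suc k)
    ≤⟨ +-monoʳ-≤ (n C k) bound ⟩
  n C k + n C suc k
    ≡⟨ nCk+nC[k+1]≡[n+1]C[k+1] n k ⟩
  suc n C suc k
    ≡⟨ sym (levelCount-+-not f (suc k)) ⟩
  levelCount f (suc k) + levelCount Z (suc k)
    ≡⟨ cong (_+ levelCount Z (suc k)) (sym (countLevel≡levelCount f (suc k))) ⟩
  countLevel f (suc k) + levelCount Z (suc k) ∎)
  where
  open ≤-Reasoning
  Z = not ∘ f
  bound : levelCount Z (suc k) ≤ n C suc k
  bound = erdős-ko-rado n Z (suc k) (ZeroSep2⇒ZeroIntersecting sep)
    (subst (suc n ≤_) (cong (suc k +_) (+-identityʳ (suc k))) n≤2k)
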